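{- If $(A,\rightarrow,\rightsquigarrow,1)$ is a commutative pseudo-BE algebra, then every pseudo-valuation on $A$ is commutative, i.e. $\mathcal{PV}^c(A)=\mathcal{PV}(A)$.
   Context: A pseudo-BE algebra is an algebra $(A,\rightarrow,\rightsquigarrow,1)$ of type $(2,2,0)$ such that for all $x,y,z\in A$: $x\rightarrow x=x\rightsquigarrow x=1$; $x\rightarrow 1=x\rightsquigarrow 1=1$; $1\rightarrow x=1\rightsquigarrow x=x$; $x\rightarrow(y\rightsquigarrow z)=y\rightsquigarrow(x\rightarrow z)$; $x\rightarrow y=1$ iff $x\rightsquigarrow y=1$. Put $x\vee_1 y=(x\rightarrow y)\rightsquigarrow y$, $x\vee_2 y=(x\rightsquigarrow y)\rightarrow y$; $A$ is commutative if $x\vee_1 y=y\vee_1 x$ and $x\vee_2 y=y\vee_2 x$ for all $x,y$. $\mathcal{PV}(A)$ is the set of pseudo-valuations: maps $\varphi:A\to\mathbb{R}$ with $\varphi(1)=0$ and $\varphi(y)-\varphi(x)\le\min\{\varphi(x\rightarrow y),\varphi(x\rightsquigarrow y)\}$ for all $x,y$. $\mathcal{PV}^c(A)$ is the set of commutative ones: those with $\varphi((x\vee_1 y)\rightarrow x)\le\varphi(y\rightarrow x)$ and $\varphi((x\vee_2 y)\rightsquigarrow x)\le\varphi(y\rightsquigarrow x)$ for all $x,y$. -}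

module Defs where

open import Level using (0ℓ)
open import Relation.Binary.PropositionalEquality using (_≡_)
open import Relation.Binary.Structures using (IsTotalOrder)
open import Algebra.Structures using (IsAbelianGroup)
open import Data.Product using (_×_)

-- Substitute for the real line ℝ (absent from agda-stdlib):
-- an arbitrary totally ordered abelian group (ℝ with +, 0, -, ≤ is one).
record OrderedAbelianGroup : Set₁ where
  infixl 6 _+_ _-_
  infix  4 _≈_ _≤_
  field
    Carrier        : Set
    _≈_            : Carrier → Carrier → Set
    _≤_            : Carrier → Carrier → Set
    _+_            : Carrier → Carrier → Carrier
    0#             : Carrier
    -_             : Carrier → Carrier
    isAbelianGroup : IsAbelianGroup _≈_ _+_ 0# -_
    isTotalOrder   : IsTotalOrder _≈_ _≤_
    +-monoˡ-≤      : ∀ {x y} z → x ≤ y → x + z ≤ y + z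

  _-_ : Carrier → Carrier → Carrier
  x - y = x + (- y)

record PseudoBE : Set₁ where
  infixr 5 _⇒_ _⇝_
  field
    Carrier : Set
    _⇒_     : Carrier → Carrier → Carrier
    _⇝_     : Carrier → Carrier → Carrier
    𝟏       : Carrier
    ⇒-refl  : ∀ x → x ⇒ x ≡ 𝟏
    ⇝-refl  : ∀ x → x ⇝ x ≡ 𝟏
    ⇒-top   : ∀ x → x ⇒ 𝟏 ≡ 𝟏
    ⇝-top   : ∀ x → x ⇝ 𝟏 ≡ 𝟏
    ⇒-unit  : ∀ x → 𝟏 ⇒ x ≡ x
    ⇝-unit  : ∀ x → 𝟏 ⇝ x ≡ x
    exch    : ∀ x y z → x ⇒ (y ⇝ z) ≡ y ⇝ (x ⇒ z)
    ⇒→⇝     : ∀ x y → x ⇒ y ≡ 𝟏 → x ⇝ y ≡ 𝟏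
    ⇝→⇒     : ∀ x y → x ⇝ y ≡ 𝟏 → x ⇒ y ≡ 𝟏

  _∨₁_ : Carrier → Carrier → Carrier
  x ∨₁ y = (x ⇒ y) ⇝ y

  _∨₂_ : Carrier → Carrier → Carrier
  x ∨₂ y = (x ⇝ y) ⇒ y

IsCommutative : PseudoBE → Set
IsCommutative A = ∀ x y → (x ∨₁ y ≡ y ∨₁ x) × (x ∨₂ y ≡ y ∨₂ x)
  where open PseudoBE A

module _ (A : PseudoBE) (R : OrderedAbelianGroup) where
  open PseudoBE A
  open OrderedAbelianGroup R renaming (Carrier to ℝ)

  -- φ(1) = 0 and φ(y) - φ(x) ≤ min{φ(x → y), φ(x ⇝ y)}
  -- (the min-bound written as the conjunction of the two bounds).
  IsPseudoValuation : (Carrier → ℝ) → Set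
  IsPseudoValuation φ =
    (φ 𝟏 ≈ 0#) ×
    (∀ x y → (φ y - φ x ≤ φ (x ⇒ y)) × (φ y - φ x ≤ φ (x ⇝ y)))

  IsCommutativePV : (Carrier → ℝ) → Set
  IsCommutativePV φ =
    IsPseudoValuation φ ×
    (∀ x y → (φ ((x ∨₁ y) ⇒ x) ≤ φ (y ⇒ x)) × (φ ((x ∨₂ y) ⇝ x) ≤ φ (y ⇝ x)))

module Submission where

-- A pseudo-valuation φ is antitone along the induced order: if
-- a ⇝ b = 1 (or a ⇒ b = 1) then φ b - φ a ≤ φ 1 = 0, hence φ b ≤ φ a.
-- In any pseudo-BE algebra the exchange law gives
--   (y ⇒ x) ⇝ ((y ∨₁ x) ⇒ x) = (y ∨₁ x) ⇒ ((y ⇒ x) ⇝ x) = (y ∨₁ x) ⇒ (y ∨₁ x) = 1,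
-- and dually (y ⇝ x) ⇒ ((y ∨₂ x) ⇝ x) = 1.  Commutativity replaces y ∨ᵢ x
-- by x ∨ᵢ y, and antitonicity then yields exactly the two inequalities
-- defining a commutative pseudo-valuation.

open import Defs
open import Data.Product using (_,_; proj₁; proj₂)
open import Relation.Binary.PropositionalEquality
  using (_≡_; refl; sym; subst; module ≡-Reasoning)
open import Algebra.Structures using (IsAbelianGroup)
open import Relation.Binary.Structures using (IsTotalOrder)

module OrderedGroupFacts (R : OrderedAbelianGroup) where
  open OrderedAbelianGroup R
  open IsAbelianGroup isAbelianGroup
    using (assoc; inverseˡ; identityˡ; identityʳ; ∙-cong)
    renaming (refl to ≈-refl; trans to ≈-trans)
  open IsTotalOrder isTotalOrder using (≲-respˡ-≈; ≲-respʳ-≈)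

  minus-plus : ∀ a b → (a - b) + b ≈ a
  minus-plus a b =
    ≈-trans (assoc a (- b) b) (≈-trans (∙-cong ≈-refl (inverseˡ b)) (identityʳ a))

  difference-nonpos : ∀ {a b z} → z ≈ 0# → a - b ≤ z → a ≤ b
  difference-nonpos {a} {b} z≈0 a-b≤z =
    ≲-respˡ-≈ (minus-plus a b)
      (≲-respʳ-≈ (identityˡ b) (+-monoˡ-≤ b (≲-respʳ-≈ z≈0 a-b≤z)))

module PseudoBEFacts (A : PseudoBE) where
  open PseudoBE A
  open ≡-Reasoning

  ⇒-∨₁-absorb : ∀ x y → (y ⇒ x) ⇝ ((y ∨₁ x) ⇒ x) ≡ 𝟏
  ⇒-∨₁-absorb x y = begin
    (y ⇒ x) ⇝ ((y ∨₁ x) ⇒ x)  ≡⟨ sym (exch (y ∨₁ x) (y ⇒ x) x) ⟩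
    (y ∨₁ x) ⇒ (y ∨₁ x)       ≡⟨ ⇒-refl (y ∨₁ x) ⟩
    𝟏                         ∎

  ⇝-∨₂-absorb : ∀ x y → (y ⇝ x) ⇒ ((y ∨₂ x) ⇝ x) ≡ 𝟏
  ⇝-∨₂-absorb x y = begin
    (y ⇝ x) ⇒ ((y ∨₂ x) ⇝ x)  ≡⟨ exch (y ⇝ x) (y ∨₂ x) x ⟩
    (y ∨₂ x) ⇝ (y ∨₂ x)       ≡⟨ ⇝-refl (y ∨₂ x) ⟩
    𝟏                         ∎

module PseudoValuationFacts (A : PseudoBE) (R : OrderedAbelianGroup)
  (φ : PseudoBE.Carrier A → OrderedAbelianGroup.Carrier R)
  (pv : IsPseudoValuation A R φ) where
  open PseudoBE A
  open OrderedAbelianGroup R using (_≤_; _≈_; 0#)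
  open OrderedGroupFacts R

  φ-vanishes : ∀ {c} → c ≡ 𝟏 → φ c ≈ 0#
  φ-vanishes refl = proj₁ pv

  ⇒-antitone : ∀ a b → a ⇒ b ≡ 𝟏 → φ b ≤ φ a
  ⇒-antitone a b a⇒b≡𝟏 = difference-nonpos (φ-vanishes a⇒b≡𝟏) (proj₁ (proj₂ pv a b))

  ⇝-antitone : ∀ a b → a ⇝ b ≡ 𝟏 → φ b ≤ φ a
  ⇝-antitone a b a⇝b≡𝟏 = difference-nonpos (φ-vanishes a⇝b≡𝟏) (proj₂ (proj₂ pv a b))

proposition6p14 : (A : PseudoBE) → IsCommutative A → (R : OrderedAbelianGroup)
    → (φ : PseudoBE.Carrier A → OrderedAbelianGroup.Carrier R)
    → IsPseudoValuation A R φ → IsCommutativePV A R φ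
proposition6p14 A comm R φ pv = pv , λ x y → ∨₁-bound x y , ∨₂-bound x y
  where
    open PseudoBE A
    open OrderedAbelianGroup R using (_≤_)
    open PseudoBEFacts A
    open PseudoValuationFacts A R φ pv

    ∨₁-bound : ∀ x y → φ ((x ∨₁ y) ⇒ x) ≤ φ (y ⇒ x)
    ∨₁-bound x y = ⇝-antitone (y ⇒ x) ((x ∨₁ y) ⇒ x)
      (subst (λ j → (y ⇒ x) ⇝ (j ⇒ x) ≡ 𝟏) (sym (proj₁ (comm x y))) (⇒-∨₁-absorb x y))

    ∨₂-bound : ∀ x y → φ ((x ∨₂ y) ⇝ x) ≤ φ (y ⇝ x)
    ∨₂-bound x y = ⇒-antitone (y ⇝ x) ((x ∨₂ y) ⇝ x)
      (subst (λ j → (y ⇝ x) ⇒ (j ⇝ x) ≡ 𝟏) (sym (proj₂ (comm x y))) (⇝-∨₂-absorb x y))
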